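{- Let $k\geq 4$. Let $G$ and $H$ be graphs on the same vertex set $V$, both of girth at least $k+1$ (i.e. with no cycles of length at most $k$), having the same family of connected $k$-sets. If $X\subseteq V$ with $|X|\geq k+2$ induces a cycle in $G$, then $H[X]=G[X]$.
   Context: For a graph $G=(V,E)$ and $k\geq 2$, the connected $k$-sets are the sets $Y\subseteq V$ with $|Y|=k$ such that $G[Y]$ is connected. The girth of a graph is the length of its shortest cycle (infinite for acyclic graphs). Graphs are finite, simple, connected and labelled. -}

module Defs where

open import Data.Nat using (ℕ; zero; suc; _≤_)
open import Data.Bool using (Bool; true; false)
open import Data.Fin using (Fin; toℕ)
open import Data.Fin.Subset using (Subset; _∈_; ⊤; ∣_∣)
open import Data.Product using (Σ; ∃; _×_; _,_)
open import Data.Sum using (_⊎_)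
open import Relation.Binary.PropositionalEquality using (_≡_)
open import Relation.Nullary using (¬_)
open import Function.Bundles using (_⇔_)
open import Function.Definitions using (Injective)

record Graph (n : ℕ) : Set where
  field
    adj   : Fin n → Fin n → Bool
    sym   : ∀ u v → adj u v ≡ adj v u
    irrefl : ∀ v → adj v v ≡ false
open Graph public

Adj : ∀ {n} → Graph n → Fin n → Fin n → Set
Adj G u v = adj G u v ≡ true

data WalkIn {n : ℕ} (G : Graph n) (Y : Subset n) : Fin n → Fin n → Set where
  stop : ∀ {u} → u ∈ Y → WalkIn G Y u u
  step : ∀ {u w v} → u ∈ Y → Adj G u w → WalkIn G Y w v → WalkIn G Y u v

InducedConnected : ∀ {n} → Graph n → Subset n → Set
InducedConnected G Y = ∀ u v → u ∈ Y → v ∈ Y → WalkIn G Y u v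

Connected : ∀ {n} → Graph n → Set
Connected G = InducedConnected G ⊤

ConnectedKSet : ∀ {n} → Graph n → ℕ → Subset n → Set
ConnectedKSet G k Y = ∣ Y ∣ ≡ k × InducedConnected G Y

CycSucc : (m : ℕ) → Fin m → Fin m → Set
CycSucc m i j = (suc (toℕ i) ≡ toℕ j) ⊎ (suc (toℕ i) ≡ m × toℕ j ≡ 0)

HasCycle : ∀ {n} → Graph n → ℕ → Set
HasCycle {n} G m = 3 ≤ m × Σ (Fin m → Fin n) λ f →
  Injective _≡_ _≡_ f × (∀ i j → CycSucc m i j → Adj G (f i) (f j))

GirthAtLeast : ∀ {n} → Graph n → ℕ → Set
GirthAtLeast G g = ∀ m → suc m ≤ g → ¬ HasCycle G m

InducesCycle : ∀ {n} → Graph n → Subset n → Set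
InducesCycle {n} G X = Σ ℕ λ m → 3 ≤ m × Σ (Fin m → Fin n) λ f →
  Injective _≡_ _≡_ f
  × (∀ v → (v ∈ X ⇔ ∃ λ i → f i ≡ v))
  × (∀ i j → (Adj G (f i) (f j) ⇔ (CycSucc m i j ⊎ CycSucc m j i)))

SameInduced : ∀ {n} → Graph n → Graph n → Subset n → Set
SameInduced G H X = ∀ u v → u ∈ X → v ∈ X → adj H u v ≡ adj G u v

{-# OPTIONS --safe #-}
-- Index the cycle induced on X periodically by ℕ, so that its arcs are intervals. Since m ≥ k + 2,
-- a k-subset of the cycle is connected in G exactly when it is an arc, so every k-arc is connected
-- in H. Then every (k − 1)-arc A is connected in H too: otherwise a component of H[A] together with
-- the two vertices flanking A is a connected set of H inside the (k + 1)-arc W around A that misses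
-- a vertex of A, and growing it inside W gives a connected k-set of H containing both ends of W,
-- which is not an arc. Hence H has no edge between cycle vertices at cyclic distance 2, …, m − 2:
-- it would join a vertex v to a (k − 1)-arc avoiding v and its neighbours into a connected k-set of
-- H that is not an arc. Finally, the first step of an H-walk from v inside the k-arc starting at v
-- must go to the successor of v, so consecutive cycle vertices are H-adjacent.
module Submission where

open import Defs hiding (sym)
open import Level using (0ℓ)
open import Data.Nat using (ℕ; zero; suc; _+_; _∸_; _*_; _%_; _/_; _≤_; _<_; z≤n; s≤s; s≤s⁻¹; NonZero; >-nonZero)
open import Data.Nat.Properties
  using (≤-refl; ≤-reflexive; ≤-trans; <-trans; <-≤-trans; ≤-<-trans; ≤-total; <⇒≤; ≤⇒≯; <⇒≱;
         n≤1+n; n<1+n; m≤n+m; m≤m+n; m<m+n; m<1+n⇒m<n∨m≡n; m≤n⇒m<n∨m≡n; m≤n⇒∃[o]m+o≡n;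
         +-suc; +-comm; +-assoc; +-identityʳ; +-monoʳ-≤; +-monoˡ-≤; +-monoʳ-<; +-monoˡ-<;
         m∸n+n≡m; [m+n]∸[m+o]≡n∸o; *-distribʳ-∸; m<n+o⇒m∸n<o; m<n⇒0<n∸m)
open import Data.Nat.DivMod
  using (_mod_; m%n<n; m%n%n≡m%n; %-distribˡ-+; m≡m%n+[m/n]*n; m<n⇒m%n≡m; n%n≡0; [m+n]%n≡m%n; [m+kn]%n≡m%n)
open import Data.Nat.Divisibility using (_∣_; divides; ∣⇒≤)
open import Data.Nat.Tactic.RingSolver using (solve-∀)
open import Data.Bool using (Bool; true; false)
open import Data.Bool.Properties using (T-≡)
open import Data.Fin using (Fin; zero; suc; toℕ)
open import Data.Fin.Properties using (toℕ-fromℕ<; toℕ-injective; toℕ<n)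
open import Data.Fin.Subset using (Subset; _∈_; _∉_; _⊆_; ∣_∣; inside; outside) renaming (⊥ to ∅)
open import Data.Fin.Subset.Properties using (drop-there; _∈?_; ∉⊥; ∣⊥∣≡0; p⊆q⇒∣p∣≤∣q∣; p⊂q⇒∣p∣<∣q∣)
open import Data.Vec using (_∷_; here; there; tabulate)
open import Data.Vec.Properties using ([]=⇒lookup; lookup⇒[]=; lookup∘tabulate)
open import Data.Product using (∃; ∃₂; _×_; _,_; proj₂)
open import Data.Sum using (_⊎_; inj₁; inj₂)
open import Data.Sum.Function.Propositional using (_⊎-⇔_)
open import Data.Empty using (⊥; ⊥-elim)
open import Function using (_∘_)
open import Function.Definitions using (Injective)
open import Function.Bundles using (_⇔_; mk⇔; Equivalence)
open import Function.Properties.Equivalence using () renaming (trans to ⇔-trans; sym to ⇔-sym)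
open import Relation.Nullary using (¬_; yes; no)
open import Relation.Nullary.Decidable using (isYes; toWitness; fromWitness)
open import Relation.Nullary.Decidable.Core using (¬¬-excluded-middle)
open import Relation.Unary using (Pred; Decidable)
open import Relation.Binary.PropositionalEquality
  using (_≡_; _≢_; refl; sym; trans; cong; cong₂; subst; subst₂; module ≡-Reasoning)

private
  variable
    n : ℕ

insert : Fin n → Subset n → Subset n
insert zero    (_ ∷ p) = inside ∷ p
insert (suc x) (b ∷ p) = b ∷ insert x p

x∈insert : (x : Fin n) (p : Subset n) → x ∈ insert x p
x∈insert zero    (_ ∷ p) = here
x∈insert (suc x) (_ ∷ p) = there (x∈insert x p)

∈⇒∈insert : ∀ {y} (x : Fin n) {p} → y ∈ p → y ∈ insert x p
∈⇒∈insert zero    {_ ∷ p} here       = here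
∈⇒∈insert zero    {_ ∷ p} (there y∈) = there y∈
∈⇒∈insert (suc x) {_ ∷ p} here       = here
∈⇒∈insert (suc x) {_ ∷ p} (there y∈) = there (∈⇒∈insert x y∈)

∈insert⁻ : ∀ {y} (x : Fin n) (p : Subset n) → y ∈ insert x p → y ≡ x ⊎ y ∈ p
∈insert⁻ zero    (_ ∷ p) here       = inj₁ refl
∈insert⁻ zero    (_ ∷ p) (there y∈) = inj₂ (there y∈)
∈insert⁻ (suc x) (_ ∷ p) here       = inj₂ here
∈insert⁻ (suc x) (_ ∷ p) (there y∈) with ∈insert⁻ x p y∈
... | inj₁ refl = inj₁ refl
... | inj₂ y∈p  = inj₂ (there y∈p)

∉insert : ∀ {y x : Fin n} {p} → y ≢ x → y ∉ p → y ∉ insert x p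
∉insert {x = x} {p} y≢x y∉p y∈ with ∈insert⁻ x p y∈
... | inj₁ y≡x = y≢x y≡x
... | inj₂ y∈p = y∉p y∈p

∣insert∣≡1+∣p∣ : (x : Fin n) (p : Subset n) → x ∉ p → ∣ insert x p ∣ ≡ suc ∣ p ∣
∣insert∣≡1+∣p∣ zero    (inside  ∷ p) x∉p = ⊥-elim (x∉p here)
∣insert∣≡1+∣p∣ zero    (outside ∷ p) x∉p = refl
∣insert∣≡1+∣p∣ (suc x) (inside  ∷ p) x∉p = cong suc (∣insert∣≡1+∣p∣ x p (x∉p ∘ there))
∣insert∣≡1+∣p∣ (suc x) (outside ∷ p) x∉p = ∣insert∣≡1+∣p∣ x p (x∉p ∘ there)

private
  there-∈∖ : ∀ {n b c} {p q : Subset n} → ∃ (λ x → x ∈ q × x ∉ p) → ∃ λ x → x ∈ c ∷ q × x ∉ b ∷ p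
  there-∈∖ (x , x∈q , x∉p) = suc x , there x∈q , x∉p ∘ drop-there

∣p∣<∣q∣⇒∃∈q∖p : (p q : Subset n) → ∣ p ∣ < ∣ q ∣ → ∃ λ x → x ∈ q × x ∉ p
∣p∣<∣q∣⇒∃∈q∖p (outside ∷ p) (inside  ∷ q) _        = zero , here , λ ()
∣p∣<∣q∣⇒∃∈q∖p (inside  ∷ p) (inside  ∷ q) (s≤s lt) = there-∈∖ (∣p∣<∣q∣⇒∃∈q∖p p q lt)
∣p∣<∣q∣⇒∃∈q∖p (outside ∷ p) (outside ∷ q) lt       = there-∈∖ (∣p∣<∣q∣⇒∃∈q∖p p q lt)
∣p∣<∣q∣⇒∃∈q∖p (inside  ∷ p) (outside ∷ q) lt       = there-∈∖ (∣p∣<∣q∣⇒∃∈q∖p p q (≤-trans (n≤1+n _) lt))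

decSubset : {P : Pred (Fin n) 0ℓ} → Decidable P → Subset n
decSubset P? = tabulate (isYes ∘ P?)

∈decSubset⇔ : {P : Pred (Fin n) 0ℓ} (P? : Decidable P) {x : Fin n} → x ∈ decSubset P? ⇔ P x
∈decSubset⇔ P? {x} = mk⇔
  (λ x∈ → toWitness (Equivalence.from T-≡ (trans (sym (lookup∘tabulate (isYes ∘ P?) x)) ([]=⇒lookup x∈))))
  (λ Px → lookup⇒[]= x _ (trans (lookup∘tabulate (isYes ∘ P?) x) (Equivalence.to T-≡ (fromWitness Px))))

¬¬-decidable : (P : Pred (Fin n) 0ℓ) → ¬ ¬ Decidable P
¬¬-decidable {zero}  P ¬P? = ¬P? λ ()
¬¬-decidable {suc n} P ¬P? = ¬¬-excluded-middle λ P0? → ¬¬-decidable (P ∘ suc) λ P? →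
  ¬P? λ { zero → P0? ; (suc x) → P? x }

≡true⇔⇒≡ : ∀ {b c : Bool} → (b ≡ true ⇔ c ≡ true) → b ≡ c
≡true⇔⇒≡ {true}          b⇔c = sym (Equivalence.to b⇔c refl)
≡true⇔⇒≡ {false} {false} _   = refl
≡true⇔⇒≡ {false} {true}  b⇔c = Equivalence.from b⇔c refl

%-cong-+ˡ : ∀ c d .{{_ : NonZero d}} {x y} → x % d ≡ y % d → (c + x) % d ≡ (c + y) % d
%-cong-+ˡ c d {x} {y} eq = begin
  (c + x) % d         ≡⟨ %-distribˡ-+ c x d ⟩
  (c % d + x % d) % d ≡⟨ cong (λ v → (c % d + v) % d) eq ⟩
  (c % d + y % d) % d ≡⟨ %-distribˡ-+ c y d ⟨
  (c + y) % d         ∎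
  where open ≡-Reasoning

%≡%⇒∣∸ : ∀ x y d .{{_ : NonZero d}} → x % d ≡ y % d → d ∣ x ∸ y
%≡%⇒∣∸ x y d eq = divides (x / d ∸ y / d) (begin
  x ∸ y                                     ≡⟨ cong₂ _∸_ (m≡m%n+[m/n]*n x d) (m≡m%n+[m/n]*n y d) ⟩
  (x % d + x / d * d) ∸ (y % d + y / d * d) ≡⟨ cong (λ v → (v + x / d * d) ∸ (y % d + y / d * d)) eq ⟩
  (y % d + x / d * d) ∸ (y % d + y / d * d) ≡⟨ [m+n]∸[m+o]≡n∸o (y % d) _ _ ⟩
  x / d * d ∸ y / d * d                     ≡⟨ *-distribʳ-∸ d (x / d) (y / d) ⟨
  (x / d ∸ y / d) * d                       ∎)
  where open ≡-Reasoning

module Walks (K : Graph n) where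

  Walk : Subset n → Fin n → Fin n → Set
  Walk = WalkIn K

  Conn : Subset n → Set
  Conn = InducedConnected K

  adj-sym : ∀ {u v} → Adj K u v → Adj K v u
  adj-sym {u} {v} uv = trans (Graph.sym K v u) uv

  adj-irrefl : ∀ {u} → ¬ Adj K u u
  adj-irrefl {u} uu with trans (sym (irrefl K u)) uu
  ... | ()

  source∈ : ∀ {Y u v} → Walk Y u v → u ∈ Y
  source∈ (stop u∈)     = u∈
  source∈ (step u∈ _ _) = u∈

  target∈ : ∀ {Y u v} → Walk Y u v → v ∈ Y
  target∈ (stop v∈)     = v∈
  target∈ (step _ _ w)  = target∈ w

  infixr 5 _++_

  _++_ : ∀ {Y u v w} → Walk Y u v → Walk Y v w → Walk Y u w
  stop _       ++ w = w
  step u∈ e w′ ++ w = step u∈ e (w′ ++ w)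

  reverse : ∀ {Y u v} → Walk Y u v → Walk Y v u
  reverse (stop u∈)     = stop u∈
  reverse (step u∈ e w) = reverse w ++ step (source∈ w) (adj-sym e) (stop u∈)

  walk-mono : ∀ {Y Z u v} → Y ⊆ Z → Walk Y u v → Walk Z u v
  walk-mono Y⊆Z (stop u∈)     = stop (Y⊆Z u∈)
  walk-mono Y⊆Z (step u∈ e w) = step (Y⊆Z u∈) e (walk-mono Y⊆Z w)

  first-edge : ∀ {Y u v} → Walk Y u v → u ≢ v → ∃ λ w → w ∈ Y × Adj K u w
  first-edge (stop _)       u≢u = ⊥-elim (u≢u refl)
  first-edge (step _ e w)   _   = _ , source∈ w , e

  edge-leaving : ∀ {U S x y} → Walk U x y → x ∈ S → y ∉ S →
                 ∃₂ λ u v → u ∈ S × v ∈ U × v ∉ S × Adj K u v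
  edge-leaving (stop _) x∈S y∉S = ⊥-elim (y∉S x∈S)
  edge-leaving {S = S} (step {w = w} _ e rest) x∈S y∉S with w ∈? S
  ... | yes w∈S = edge-leaving rest w∈S y∉S
  ... | no  w∉S = _ , w , x∈S , source∈ rest , w∉S , e

  connected-from : ∀ {Y x} → x ∈ Y → (∀ y → y ∈ Y → Walk Y x y) → Conn Y
  connected-from x∈Y walk u v u∈Y v∈Y = reverse (walk u u∈Y) ++ walk v v∈Y

  connected-insert : ∀ {Y y z} → Conn Y → y ∈ Y → Adj K z y → Conn (insert z Y)
  connected-insert {Y} {y} {z} conn y∈Y zy = connected-from (x∈insert z Y) walk
    where
    walk : ∀ v → v ∈ insert z Y → Walk (insert z Y) z v
    walk v v∈ with ∈insert⁻ z Y v∈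
    ... | inj₁ refl = stop (x∈insert z Y)
    ... | inj₂ v∈Y  = step (x∈insert z Y) zy (walk-mono (∈⇒∈insert z) (conn y v y∈Y v∈Y))

  connected-∪ : ∀ {Y₁ Y₂ Z z} → Conn Y₁ → Conn Y₂ → z ∈ Y₁ → z ∈ Y₂ → Y₁ ⊆ Z → Y₂ ⊆ Z →
                (∀ {y} → y ∈ Z → y ∈ Y₁ ⊎ y ∈ Y₂) → Conn Z
  connected-∪ {z = z} conn₁ conn₂ z∈₁ z∈₂ ⊆₁ ⊆₂ cover = connected-from (⊆₁ z∈₁) walk
    where
    walk : ∀ y → y ∈ _ → Walk _ z y
    walk y y∈Z with cover y∈Z
    ... | inj₁ y∈₁ = walk-mono ⊆₁ (conn₁ z y z∈₁ y∈₁)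
    ... | inj₂ y∈₂ = walk-mono ⊆₂ (conn₂ z y z∈₂ y∈₂)

  extend-connected : ∀ d {T Z x c} → d + ∣ T ∣ ≡ c → c ≤ ∣ Z ∣ → T ⊆ Z → x ∈ T → Conn T → Conn Z →
                     ∃ λ T′ → T ⊆ T′ × T′ ⊆ Z × ∣ T′ ∣ ≡ c × Conn T′
  extend-connected zero {T} refl _ T⊆Z _ connT _ = T , (λ t∈ → t∈) , T⊆Z , refl , connT
  extend-connected (suc d) {T} {Z} {x} refl c≤ T⊆Z x∈T connT connZ
    with ∣p∣<∣q∣⇒∃∈q∖p T Z (≤-trans (s≤s (m≤n+m ∣ T ∣ d)) c≤)
  ... | w , w∈Z , w∉T with edge-leaving (connZ x w (T⊆Z x∈T) w∈Z) x∈T w∉T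
  ... | u , v , u∈T , v∈Z , v∉T , uv
    with extend-connected d {insert v T} (trans (cong (d +_) (∣insert∣≡1+∣p∣ v T v∉T)) (+-suc d ∣ T ∣))
           c≤ insert⊆Z (∈⇒∈insert v x∈T) (connected-insert connT u∈T (adj-sym uv)) connZ
    where
    insert⊆Z : insert v T ⊆ Z
    insert⊆Z y∈ with ∈insert⁻ v T y∈
    ... | inj₁ refl = v∈Z
    ... | inj₂ y∈T  = T⊆Z y∈T
  ... | T′ , ⊆T′ , T′⊆Z , ∣T′∣ , connT′ = T′ , ⊆T′ ∘ ∈⇒∈insert v , T′⊆Z , ∣T′∣ , connT′

  module Component {A : Subset n} {x : Fin n} (x∈A : x ∈ A) (reach? : Decidable (Walk A x)) where

    C : Subset n
    C = decSubset reach?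

    reached : ∀ {z} → Walk A x z → z ∈ C
    reached = Equivalence.from (∈decSubset⇔ reach?)

    reaching : ∀ {z} → z ∈ C → Walk A x z
    reaching = Equivalence.to (∈decSubset⇔ reach?)

    C⊆A : C ⊆ A
    C⊆A = target∈ ∘ reaching

    C-closed : ∀ {u v} → u ∈ C → v ∈ A → Adj K u v → v ∈ C
    C-closed u∈C v∈A uv = reached (reaching u∈C ++ step (C⊆A u∈C) uv (stop v∈A))

    restrict : ∀ {u v} → Walk A x u → Walk A u v → Walk C u v
    restrict xu (stop _)        = stop (reached xu)
    restrict xu (step u∈A uw w) = step (reached xu) uw (restrict (xu ++ step u∈A uw (stop (source∈ w))) w)

    C-connected : Conn C
    C-connected = connected-from (reached (stop x∈A)) λ _ y∈C → restrict (stop x∈A) (reaching y∈C)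

    edge-into-C : ∀ {D e} → Conn D → x ∈ D → e ∈ D → e ∉ A → (∀ {z} → z ∈ D → z ≡ e ⊎ z ∈ A) →
                  ∃ λ u → u ∈ C × Adj K e u
    edge-into-C {e = e} connD x∈D e∈D e∉A D⊆eA
      with edge-leaving (connD x e x∈D e∈D) (reached (stop x∈A)) (e∉A ∘ C⊆A)
    ... | u , v , u∈C , v∈D , v∉C , uv with D⊆eA v∈D
    ... | inj₁ refl = u , u∈C , adj-sym uv
    ... | inj₂ v∈A  = ⊥-elim (v∉C (C-closed u∈C v∈A uv))

Consecutive : (ℕ → Fin n) → ℕ → ℕ → Set
Consecutive a p q = a q ≡ a (suc p) ⊎ a p ≡ a (suc q)

-- Positions on the cycle are lifted from ℤ/mℤ to ℕ.
record CyclicEnumeration (G : Graph n) (X : Subset n) (m : ℕ) : Set where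
  field
    vertex          : ℕ → Fin n
    vertex∈X        : ∀ p → vertex p ∈ X
    X⊆vertices      : ∀ {v} → v ∈ X → ∃ λ p → vertex p ≡ v
    periodic        : ∀ p → vertex (p + m) ≡ vertex p
    injective       : ∀ {p q} → q < p → p < q + m → vertex p ≢ vertex q
    offset          : ∀ p q → ∃ λ d → d < m × vertex (q + d) ≡ vertex p
    suc-cong        : ∀ {p q} → vertex (suc p) ≡ vertex (suc q) ⇔ vertex p ≡ vertex q
    adj⇔consecutive : ∀ p q → Adj G (vertex p) (vertex q) ⇔ Consecutive vertex p q

module Arcs {G : Graph n} {X : Subset n} {m : ℕ} (E : CyclicEnumeration G X m) where

  open CyclicEnumeration E renaming (vertex to a)
  open Walks G

  G-step : ∀ p → Adj G (a p) (a (suc p))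
  G-step p = Equivalence.from (adj⇔consecutive p (suc p)) (inj₁ refl)

  arc : ℕ → ℕ → Subset n
  arc s zero    = ∅
  arc s (suc L) = insert (a (s + L)) (arc s L)

  ∈-arc : ∀ {s p} L → s ≤ p → p < s + L → a p ∈ arc s L
  ∈-arc {s} {p} zero    s≤p p< = ⊥-elim (≤⇒≯ s≤p (subst (p <_) (+-identityʳ s) p<))
  ∈-arc {s} {p} (suc L) s≤p p< with m<1+n⇒m<n∨m≡n (subst (p <_) (+-suc s L) p<)
  ... | inj₁ p<s+L = ∈⇒∈insert (a (s + L)) (∈-arc L s≤p p<s+L)
  ... | inj₂ refl  = x∈insert (a (s + L)) (arc s L)

  arc-∈ : ∀ {s y} L → y ∈ arc s L → ∃ λ p → s ≤ p × p < s + L × a p ≡ y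
  arc-∈ zero y∈ = ⊥-elim (∉⊥ y∈)
  arc-∈ {s} (suc L) y∈ with ∈insert⁻ (a (s + L)) (arc s L) y∈
  ... | inj₁ refl = s + L , m≤m+n s L , +-monoʳ-< s (n<1+n L) , refl
  ... | inj₂ y∈′ with arc-∈ L y∈′
  ... | p , s≤p , p< , refl = p , s≤p , <-trans p< (+-monoʳ-< s (n<1+n L)) , refl

  arc⊆X : ∀ {s} L → arc s L ⊆ X
  arc⊆X L y∈ with arc-∈ L y∈
  ... | p , _ , _ , refl = vertex∈X p

  arc-mono : ∀ {s s′} L L′ → s′ ≤ s → s + L ≤ s′ + L′ → arc s L ⊆ arc s′ L′
  arc-mono L L′ s′≤s ≤s′+L′ y∈ with arc-∈ L y∈
  ... | p , s≤p , p< , refl = ∈-arc L′ (≤-trans s′≤s s≤p) (<-≤-trans p< ≤s′+L′)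

  arc-first : ∀ {s y} L → y ∈ arc s (suc L) → y ≡ a s ⊎ y ∈ arc (suc s) L
  arc-first {s} L y∈ with arc-∈ (suc L) y∈
  ... | p , s≤p , p< , refl with m≤n⇒m<n∨m≡n s≤p
  ... | inj₁ s<p  = inj₂ (∈-arc L s<p (subst (p <_) (+-suc s L) p<))
  ... | inj₂ refl = inj₁ refl

  ∉arc-before : ∀ {q s} L → q < s → s + L ≤ q + m → a q ∉ arc s L
  ∉arc-before L q<s ≤q+m aq∈ with arc-∈ L aq∈
  ... | p , s≤p , p< , ap≡aq = injective (<-≤-trans q<s s≤p) (<-≤-trans p< ≤q+m) ap≡aq

  ∉arc-after : ∀ {q s} L → s + L ≤ q → q < s + m → a q ∉ arc s L
  ∉arc-after L s+L≤q q< aq∈ with arc-∈ L aq∈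
  ... | p , s≤p , p< , ap≡aq = injective (<-≤-trans p< s+L≤q) (<-≤-trans q< (+-monoˡ-≤ m s≤p)) (sym ap≡aq)

  ∣arc∣≡ : ∀ {s} L → L ≤ m → ∣ arc s L ∣ ≡ L
  ∣arc∣≡ zero    _   = ∣⊥∣≡0 n
  ∣arc∣≡ {s} (suc L) L<m = trans (∣insert∣≡1+∣p∣ (a (s + L)) (arc s L) (∉arc-after L ≤-refl (+-monoʳ-< s L<m)))
                               (cong suc (∣arc∣≡ L (<⇒≤ L<m)))

  arc-path : ∀ {s p} L q → s ≤ p → p ≤ q → q < s + L → Walk (arc s L) (a p) (a q)
  arc-path L q s≤p p≤q q< with m≤n⇒m<n∨m≡n p≤q
  ... | inj₂ refl = stop (∈-arc L s≤p q<)
  arc-path L zero    s≤p p≤q q< | inj₁ ()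
  arc-path L (suc q) s≤p p≤q q< | inj₁ p<1+q =
    arc-path L q s≤p p≤q′ q′< ++ step (∈-arc L (≤-trans s≤p p≤q′) q′<) (G-step q) (stop (∈-arc L (≤-trans s≤p p≤q) q<))
    where
    p≤q′ = s≤s⁻¹ p<1+q
    q′<  = <-trans (n<1+n q) q<

  arc-connected : ∀ s L → Conn (arc s L)
  arc-connected s L u v u∈ v∈ with arc-∈ L u∈ | arc-∈ L v∈
  ... | p , s≤p , p< , refl | q , s≤q , q< , refl with ≤-total p q
  ... | inj₁ p≤q = arc-path L q s≤p p≤q q<
  ... | inj₂ q≤p = reverse (arc-path L p s≤q q≤p p<)

  ∣X∣≤m : ∣ X ∣ ≤ m
  ∣X∣≤m = ≤-trans (p⊆q⇒∣p∣≤∣q∣ X⊆arc) (≤-reflexive (∣arc∣≡ m ≤-refl))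
    where
    X⊆arc : X ⊆ arc 0 m
    X⊆arc v∈X with X⊆vertices v∈X
    ... | p , refl with offset p 0
    ... | d , d<m , ad≡ap = subst (_∈ arc 0 m) ad≡ap (∈-arc m z≤n d<m)

  walk-confined : ∀ {Y g h t u x} → Y ⊆ X → a g ∉ Y → a h ∉ Y → g < t → t < h →
                  a t ≡ u → Walk Y u x → ∃ λ t′ → g < t′ × t′ < h × a t′ ≡ x
  walk-confined _ _ _ g<t t<h at≡u (stop _) = _ , g<t , t<h , at≡u
  walk-confined {t = zero} _ _ _ () _ _ (step _ _ _)
  walk-confined {Y} {t = suc t} Y⊆X ag∉ ah∉ g<t t<h refl (step _ e rest)
    with X⊆vertices (Y⊆X (source∈ rest))
  ... | p , refl with Equivalence.to (adj⇔consecutive (suc t) p) e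
  ... | inj₁ ap≡ with m≤n⇒m<n∨m≡n t<h
  ...   | inj₂ refl = ⊥-elim (ah∉ (subst (_∈ Y) ap≡ (source∈ rest)))
  ...   | inj₁ t′<h = walk-confined Y⊆X ag∉ ah∉ (<-trans g<t (n<1+n _)) t′<h (sym ap≡) rest
  walk-confined {Y} {t = suc t} Y⊆X ag∉ ah∉ g<t t<h refl (step _ e rest)
    | p , refl | inj₂ a1+t≡ with Equivalence.to suc-cong a1+t≡ | m≤n⇒m<n∨m≡n (s≤s⁻¹ g<t)
  ... | at≡ap | inj₂ refl = ⊥-elim (ag∉ (subst (_∈ Y) (sym at≡ap) (source∈ rest)))
  ... | at≡ap | inj₁ g<t′ = walk-confined Y⊆X ag∉ ah∉ g<t′ (<-trans (n<1+n t) t<h) at≡ap rest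

  ¬connected-missing-interior : ∀ {s L Y z} → suc L < m → Y ⊆ arc s (suc L) → a s ∈ Y → a (s + L) ∈ Y →
                                z ∈ arc s (suc L) → z ∉ Y → ¬ Conn Y
  ¬connected-missing-interior {s} {L} {Y} 1+L<m Y⊆ as∈ asL∈ z∈ z∉ connY
    with arc-∈ (suc L) z∈
  ... | p , s≤p , p< , refl
    with m≤n⇒m<n∨m≡n s≤p | m≤n⇒m<n∨m≡n (s≤s⁻¹ (subst (p <_) (+-suc s L) p<))
  ... | inj₂ refl | _         = z∉ as∈
  ... | inj₁ _    | inj₂ refl = z∉ asL∈
  ... | inj₁ s<p  | inj₁ p<s+L
    with walk-confined (arc⊆X (suc L) ∘ Y⊆) z∉ (∉arc-after (suc L) ≤-refl (+-monoʳ-< s 1+L<m) ∘ Y⊆)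
           p<s+L (+-monoʳ-< s (n<1+n L)) refl (connY (a (s + L)) (a s) asL∈ as∈)
  ... | t′ , p<t′ , t′< , at′≡as = injective (<-trans s<p p<t′) (<-trans t′< (+-monoʳ-< s 1+L<m)) at′≡as

  ¬connected-insert-far : ∀ {q s L} → 0 < L → 2 + q ≤ s → s + suc L ≤ q + m → ¬ Conn (insert (a q) (arc s L))
  ¬connected-insert-far {q} {s} {L} 0<L 2+q≤s ≤q+m connY =
    -- the walk from a q is read as starting at position q + m, just above the arc
    confined-absurd (walk-confined Y⊆X asL∉ a1+q+m∉ s+L<q+m (n<1+n (q + m)) (periodic q)
                      (connY (a q) (a s) (x∈insert (a q) (arc s L)) as∈))
    where
    Y = insert (a q) (arc s L)
    Y⊆X : Y ⊆ X
    Y⊆X y∈ with ∈insert⁻ (a q) (arc s L) y∈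
    ... | inj₁ refl = vertex∈X q
    ... | inj₂ y∈′  = arc⊆X L y∈′
    as∈ : a s ∈ Y
    as∈ = ∈⇒∈insert (a q) (∈-arc L ≤-refl (m<m+n s 0<L))
    q<s : q < s
    q<s = <-trans (n<1+n q) 2+q≤s
    s+L<q+m : s + L < q + m
    s+L<q+m = subst (_≤ q + m) (+-suc s L) ≤q+m
    q+m<s+m : q + m < s + m
    q+m<s+m = +-monoˡ-< m q<s
    asL∉ : a (s + L) ∉ Y
    asL∉ = ∉insert (injective (<-≤-trans q<s (m≤m+n s L)) s+L<q+m)
                   (∉arc-after L ≤-refl (<-trans s+L<q+m q+m<s+m))
    a1+q+m∉ : a (suc q + m) ∉ Y
    a1+q+m∉ = subst (_∉ Y) (sym (periodic (suc q)))
      (∉insert (injective (n<1+n q) (<-≤-trans 2+q≤s (≤-trans (m≤m+n s L) (<⇒≤ s+L<q+m))))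
               (∉arc-before L 2+q≤s (≤-trans (<⇒≤ s+L<q+m) (n≤1+n (q + m)))))
    confined-absurd : ¬ ∃ λ t′ → s + L < t′ × t′ < suc q + m × a t′ ≡ a s
    confined-absurd (t′ , s+L<t′ , t′<1+q+m , at′≡as) =
      injective (≤-<-trans (m≤m+n s L) s+L<t′) (<-≤-trans t′<1+q+m (+-monoˡ-≤ m q<s)) at′≡as

module SameConnectedKSets {G H : Graph n} {X : Subset n} {m : ℕ} (E : CyclicEnumeration G X m)
  (k₁ : ℕ) (1≤k₁ : 1 ≤ k₁) (3+k₁≤m : 3 + k₁ ≤ m)
  (same : ∀ Y → ConnectedKSet G (suc k₁) Y ⇔ ConnectedKSet H (suc k₁) Y) where

  open CyclicEnumeration E renaming (vertex to a)
  open Arcs E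
  module G = Walks G
  module H = Walks H

  k : ℕ
  k = suc k₁

  k<m : k < m
  k<m = <-trans (n<1+n k) 3+k₁≤m

  1+p<p+ : ∀ {p j} → 1 < j → suc p < p + j
  1+p<p+ {p} {j} 1<j = subst (_< p + j) (+-comm p 1) (+-monoʳ-< p 1<j)

  transfer-to-H : ∀ {Y} → ∣ Y ∣ ≡ k → G.Conn Y → H.Conn Y
  transfer-to-H {Y} ∣Y∣ conn = proj₂ (Equivalence.to (same Y) (∣Y∣ , conn))

  transfer-to-G : ∀ {Y} → ∣ Y ∣ ≡ k → H.Conn Y → G.Conn Y
  transfer-to-G {Y} ∣Y∣ conn = proj₂ (Equivalence.from (same Y) (∣Y∣ , conn))

  arc-H-connected : ∀ s → H.Conn (arc s k)
  arc-H-connected s = transfer-to-H (∣arc∣≡ k (<⇒≤ k<m)) (arc-connected s k)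

  module Separation (s : ℕ) (reach? : Decidable (H.Walk (arc (suc s) k₁) (a (suc s)))) where

    A B D W : Subset n
    A = arc (suc s) k₁
    B = arc s k
    D = arc (suc s) k
    W = arc s (suc k)

    A⊆B : A ⊆ B
    A⊆B = arc-mono k₁ k (n≤1+n s) (≤-reflexive (sym (+-suc s k₁)))

    A⊆D : A ⊆ D
    A⊆D = arc-mono k₁ k ≤-refl (+-monoʳ-≤ (suc s) (n≤1+n k₁))

    D⊆W : D ⊆ W
    D⊆W = arc-mono k (suc k) (n≤1+n s) (≤-reflexive (sym (+-suc s k)))

    x∈A : a (suc s) ∈ A
    x∈A = ∈-arc k₁ ≤-refl (m<m+n (suc s) 1≤k₁)

    as∈B : a s ∈ B
    as∈B = ∈-arc k ≤-refl (m<m+n s (s≤s z≤n))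

    ae∈D : a (s + k) ∈ D
    ae∈D = ∈-arc k (≤-trans (s≤s (m≤m+n s k₁)) (≤-reflexive (sym (+-suc s k₁)))) (n<1+n (s + k))

    as∉A : a s ∉ A
    as∉A = ∉arc-before k₁ (n<1+n s) (≤-trans (≤-reflexive (sym (+-suc s k₁))) (+-monoʳ-≤ s (<⇒≤ k<m)))

    ae∉A : a (s + k) ∉ A
    ae∉A = ∉arc-after k₁ (≤-reflexive (sym (+-suc s k₁))) (<-trans (+-monoʳ-< s k<m) (n<1+n (s + m)))

    D-split : ∀ {z} → z ∈ D → z ≡ a (s + k) ⊎ z ∈ A
    D-split z∈ with ∈insert⁻ (a (suc s + k₁)) A z∈
    ... | inj₁ refl = inj₁ (cong a (sym (+-suc s k₁)))
    ... | inj₂ z∈A  = inj₂ z∈A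

    W-connected : H.Conn W
    W-connected = H.connected-∪ (arc-H-connected s) (arc-H-connected (suc s)) (A⊆B x∈A) (A⊆D x∈A)
                    (∈⇒∈insert (a (s + k))) D⊆W W-cover
      where
      W-cover : ∀ {z} → z ∈ W → z ∈ B ⊎ z ∈ D
      W-cover z∈ with ∈insert⁻ (a (s + k)) B z∈
      ... | inj₁ refl = inj₂ ae∈D
      ... | inj₂ z∈B  = inj₁ z∈B

    open H.Component x∈A reach?

    T : Subset n
    T = insert (a (s + k)) (insert (a s) C)

    T-connected : H.Conn T
    T-connected
      with edge-into-C (arc-H-connected s) (A⊆B x∈A) as∈B as∉A (arc-first k₁)
         | edge-into-C (arc-H-connected (suc s)) (A⊆D x∈A) ae∈D ae∉A D-split
    ... | u , u∈C , as-u | v , v∈C , ae-v =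
      H.connected-insert (H.connected-insert C-connected u∈C as-u) (∈⇒∈insert (a s) v∈C) ae-v

    as∈T : a s ∈ T
    as∈T = ∈⇒∈insert (a (s + k)) (x∈insert (a s) C)

    ae∈T : a (s + k) ∈ T
    ae∈T = x∈insert (a (s + k)) (insert (a s) C)

    T⊆W : T ⊆ W
    T⊆W z∈ with ∈insert⁻ (a (s + k)) (insert (a s) C) z∈
    ... | inj₁ refl = x∈insert (a (s + k)) B
    ... | inj₂ z∈′ with ∈insert⁻ (a s) C z∈′
    ... | inj₁ refl = ∈⇒∈insert (a (s + k)) as∈B
    ... | inj₂ z∈C  = ∈⇒∈insert (a (s + k)) (A⊆B (C⊆A z∈C))

    ∣W∣ : ∣ W ∣ ≡ suc k
    ∣W∣ = ∣arc∣≡ (suc k) k<m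

    unreachable-absurd : ∀ {y} → y ∈ A → ¬ H.Walk A (a (suc s)) y → ⊥
    unreachable-absurd {y} y∈A ¬xy
      with H.extend-connected (k ∸ ∣ T ∣) (m∸n+n≡m ∣T∣≤k) (subst (k ≤_) (sym ∣W∣) (n≤1+n k))
             T⊆W as∈T T-connected W-connected
      where
      y∉T : y ∉ T
      y∉T = ∉insert (λ { refl → ae∉A y∈A }) (∉insert (λ { refl → as∉A y∈A }) (¬xy ∘ reaching))
      ∣T∣≤k : ∣ T ∣ ≤ k
      ∣T∣≤k = s≤s⁻¹ (subst (∣ T ∣ <_) ∣W∣ (p⊂q⇒∣p∣<∣q∣ (T⊆W , y , ∈⇒∈insert (a (s + k)) (A⊆B y∈A) , y∉T)))
    ... | T′ , T⊆T′ , T′⊆W , ∣T′∣ , T′-connected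
      with ∣p∣<∣q∣⇒∃∈q∖p T′ W (subst₂ _<_ (sym ∣T′∣) (sym ∣W∣) (n<1+n k))
    ... | z , z∈W , z∉T′ =
      ¬connected-missing-interior 3+k₁≤m T′⊆W (T⊆T′ as∈T) (T⊆T′ ae∈T) z∈W z∉T′ (transfer-to-G ∣T′∣ T′-connected)

  -- Reachability inside the arc is not decidable here, but the goal is negative, so we may assume it
  -- in order to form the component of a (suc s).
  short-arc-connected : ∀ s → ¬ ¬ H.Conn (arc (suc s) k₁)
  short-arc-connected s ¬conn = ¬¬-decidable (H.Walk A x) λ reach? → ¬conn (H.connected-from x∈A (reachable reach?))
    where
    A = arc (suc s) k₁
    x = a (suc s)
    x∈A : x ∈ A
    x∈A = ∈-arc k₁ ≤-refl (m<m+n (suc s) 1≤k₁)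
    reachable : Decidable (H.Walk A x) → ∀ y → y ∈ A → H.Walk A x y
    reachable reach? y y∈A with reach? y
    ... | yes xy = xy
    ... | no ¬xy = ⊥-elim (Separation.unreachable-absurd s reach? y∈A ¬xy)

  no-edge-to-far-arc : ∀ {q s y} → 2 + q ≤ s → s + k ≤ q + m → y ∈ arc s k₁ → ¬ Adj H (a q) y
  no-edge-to-far-arc {q} {suc s} 2+q≤ ≤q+m y∈ aq-y = short-arc-connected s λ connA →
    ¬connected-insert-far 1≤k₁ 2+q≤ ≤q+m (transfer-to-G ∣Y∣ (H.connected-insert connA y∈ aq-y))
    where
    ∣Y∣ : ∣ insert (a q) (arc (suc s) k₁) ∣ ≡ k
    ∣Y∣ = trans (∣insert∣≡1+∣p∣ (a q) (arc (suc s) k₁)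
                   (∉arc-before k₁ (<-trans (n<1+n q) 2+q≤) (≤-trans (+-monoʳ-≤ (suc s) (n≤1+n k₁)) ≤q+m)))
                (cong suc (∣arc∣≡ k₁ (≤-trans (n≤1+n k₁) (<⇒≤ k<m))))

  chord-window : ∀ d → 2 ≤ d → 2 + d ≤ m → ∃ λ e → 2 + e ≤ d × d < 2 + e + k₁ × 2 + e + k ≤ m
  chord-window d 2≤d 2+d≤m with ≤-total d k
  ... | inj₁ d≤k = 0 , 2≤d , s≤s d≤k , 3+k₁≤m
  ... | inj₂ k≤d with m≤n⇒∃[o]m+o≡n k≤d
  ... | e , refl = e , +-monoˡ-≤ e (s≤s 1≤k₁) , s≤s (s≤s (≤-reflexive (+-comm k₁ e))) ,
                   subst (_≤ m) (cong (2 +_) (+-comm k e)) 2+d≤m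

  no-chord : ∀ q d → 2 ≤ d → 2 + d ≤ m → ¬ Adj H (a q) (a (q + d))
  no-chord q d 2≤d 2+d≤m with chord-window d 2≤d 2+d≤m
  ... | e , 2+e≤d , d< , 2+e+k≤m =
    no-edge-to-far-arc 2+q≤s s+k≤q+m (∈-arc k₁ (+-monoʳ-≤ q 2+e≤d) q+d<s+k₁)
    where
    2+q≤s : 2 + q ≤ q + (2 + e)
    2+q≤s = subst (_≤ q + (2 + e)) (+-comm q 2) (+-monoʳ-≤ q (m≤m+n 2 e))
    s+k≤q+m : q + (2 + e) + k ≤ q + m
    s+k≤q+m = subst (_≤ q + m) (sym (+-assoc q (2 + e) k)) (+-monoʳ-≤ q 2+e+k≤m)
    q+d<s+k₁ : q + d < q + (2 + e) + k₁
    q+d<s+k₁ = subst (q + d <_) (sym (+-assoc q (2 + e) k₁)) (+-monoʳ-< q d<)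

  H-adj⇒consecutive : ∀ p q → Adj H (a p) (a q) → Consecutive a p q
  H-adj⇒consecutive p q ap-aq with offset p q
  ... | zero , _ , aq+0≡ap =
    ⊥-elim (H.adj-irrefl (subst (λ v → Adj H v (a q)) (trans (sym aq+0≡ap) (cong a (+-identityʳ q))) ap-aq))
  ... | suc zero , _ , aq+1≡ap = inj₂ (trans (sym aq+1≡ap) (cong a (+-comm q 1)))
  ... | suc (suc d) , 2+d<m , aq+2+d≡ap with m≤n⇒m<n∨m≡n 2+d<m
  ...   | inj₁ 3+d<m = ⊥-elim (no-chord q (2 + d) (s≤s (s≤s z≤n)) 3+d<m
                                 (subst (Adj H (a q)) (sym aq+2+d≡ap) (H.adj-sym ap-aq)))
  ...   | inj₂ 3+d≡m = inj₁ (begin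
    a q                   ≡⟨ sym (periodic q) ⟩
    a (q + m)             ≡⟨ cong (λ j → a (q + j)) (sym 3+d≡m) ⟩
    a (q + suc (2 + d))   ≡⟨ cong a (+-suc q (2 + d)) ⟩
    a (suc (q + (2 + d))) ≡⟨ Equivalence.from suc-cong aq+2+d≡ap ⟩
    a (suc p)             ∎)
    where open ≡-Reasoning

  H-step : ∀ p → Adj H (a p) (a (suc p))
  H-step p with H.first-edge (arc-H-connected p (a p) (a (suc p)) ap∈ a1+p∈) ap≢a1+p
    where
    ap∈   = ∈-arc k ≤-refl (m<m+n p (s≤s z≤n))
    a1+p∈ = ∈-arc k (n≤1+n p) (1+p<p+ (s≤s 1≤k₁))
    ap≢a1+p : a p ≢ a (suc p)
    ap≢a1+p = injective (n<1+n p) (1+p<p+ (<-≤-trans (s≤s 1≤k₁) (<⇒≤ k<m))) ∘ sym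
  ... | w , w∈ , ap-w with arc-∈ k w∈
  ... | r , p≤r , r< , refl with H-adj⇒consecutive p r ap-w
  ... | inj₁ ar≡a1+p = subst (Adj H (a p)) ar≡a1+p ap-w
  ... | inj₂ ap≡a1+r = ⊥-elim (injective (s≤s p≤r) (≤-<-trans r< (+-monoʳ-< p k<m)) (sym ap≡a1+r))

  H-adj⇔consecutive : ∀ p q → Adj H (a p) (a q) ⇔ Consecutive a p q
  H-adj⇔consecutive p q = mk⇔ (H-adj⇒consecutive p q) λ where
    (inj₁ aq≡) → subst (Adj H (a p)) (sym aq≡) (H-step p)
    (inj₂ ap≡) → H.adj-sym (subst (Adj H (a q)) (sym ap≡) (H-step q))

same-connected-k-sets⇒adj⇔consecutive :
  ∀ {G H : Graph n} {X m k} (E : CyclicEnumeration G X m) → let open CyclicEnumeration E in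
  2 ≤ k → k + 2 ≤ m → (∀ Y → ConnectedKSet G k Y ⇔ ConnectedKSet H k Y) →
  ∀ p q → Adj H (vertex p) (vertex q) ⇔ Consecutive vertex p q
same-connected-k-sets⇒adj⇔consecutive {m = m} {suc k₁} E (s≤s 1≤k₁) k+2≤m same =
  SameConnectedKSets.H-adj⇔consecutive E k₁ 1≤k₁ (subst (_≤ m) (+-comm (suc k₁) 2) k+2≤m) same

module InducedCycle {G : Graph n} {X : Subset n} (m₁ : ℕ) (f : Fin (suc m₁) → Fin n)
  (f-injective : Injective _≡_ _≡_ f)
  (X⇔ : ∀ v → (v ∈ X ⇔ ∃ λ i → f i ≡ v))
  (G⇔ : ∀ i j → (Adj G (f i) (f j) ⇔ (CycSucc (suc m₁) i j ⊎ CycSucc (suc m₁) j i))) where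

  m : ℕ
  m = suc m₁

  a : ℕ → Fin n
  a t = f (t mod m)

  toℕ-mod : ∀ t → toℕ (t mod m) ≡ t % m
  toℕ-mod t = toℕ-fromℕ< (m%n<n t m)

  a≡⇔ : ∀ p q → a p ≡ a q ⇔ p % m ≡ q % m
  a≡⇔ p q = mk⇔
    (λ eq → trans (sym (toℕ-mod p)) (trans (cong toℕ (f-injective eq)) (toℕ-mod q)))
    (λ eq → cong f (toℕ-injective (trans (toℕ-mod p) (trans eq (sym (toℕ-mod q))))))

  suc-%-reduce : ∀ p → suc p % m ≡ suc (p % m) % m
  suc-%-reduce p = %-cong-+ˡ 1 m (sym (m%n%n≡m%n p m))

  cycSucc⇔ : ∀ (i j : Fin m) → CycSucc m i j ⇔ suc (toℕ i) % m ≡ toℕ j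
  cycSucc⇔ i j = mk⇔ forward backward
    where
    forward : CycSucc m i j → suc (toℕ i) % m ≡ toℕ j
    forward (inj₁ 1+i≡j)        = trans (cong (_% m) 1+i≡j) (m<n⇒m%n≡m (toℕ<n j))
    forward (inj₂ (1+i≡m , j≡0)) = trans (cong (_% m) 1+i≡m) (trans (n%n≡0 m) (sym j≡0))
    backward : suc (toℕ i) % m ≡ toℕ j → CycSucc m i j
    backward eq with m≤n⇒m<n∨m≡n (toℕ<n i)
    ... | inj₁ 1+i<m = inj₁ (trans (sym (m<n⇒m%n≡m 1+i<m)) eq)
    ... | inj₂ 1+i≡m = inj₂ (1+i≡m , trans (sym eq) (trans (cong (_% m) 1+i≡m) (n%n≡0 m)))

  successor⇔ : ∀ p q → CycSucc m (p mod m) (q mod m) ⇔ a q ≡ a (suc p)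
  successor⇔ p q = ⇔-trans (cycSucc⇔ (p mod m) (q mod m)) (mk⇔ to from)
    where
    residue : suc (toℕ (p mod m)) % m ≡ suc p % m
    residue = trans (cong (λ r → suc r % m) (toℕ-mod p)) (sym (suc-%-reduce p))
    to : suc (toℕ (p mod m)) % m ≡ toℕ (q mod m) → a q ≡ a (suc p)
    to eq = Equivalence.from (a≡⇔ q (suc p)) (sym (subst₂ _≡_ residue (toℕ-mod q) eq))
    from : a q ≡ a (suc p) → suc (toℕ (p mod m)) % m ≡ toℕ (q mod m)
    from eq = subst₂ _≡_ (sym residue) (sym (toℕ-mod q)) (sym (Equivalence.to (a≡⇔ q (suc p)) eq))

  X⊆vertices : ∀ {v} → v ∈ X → ∃ λ p → a p ≡ v
  X⊆vertices {v} v∈X with Equivalence.to (X⇔ v) v∈X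
  ... | i , refl = toℕ i , cong f (toℕ-injective (trans (toℕ-mod (toℕ i)) (m<n⇒m%n≡m (toℕ<n i))))

  injective : ∀ {p q} → q < p → p < q + m → a p ≢ a q
  injective {p} {q} q<p p<q+m ap≡aq =
    <⇒≱ (m<n+o⇒m∸n<o p q p<q+m) (∣⇒≤ ⦃ >-nonZero (m<n⇒0<n∸m q<p) ⦄ (%≡%⇒∣∸ p q m (Equivalence.to (a≡⇔ p q) ap≡aq)))

  offset : ∀ p q → ∃ λ d → d < m × a (q + d) ≡ a p
  offset p q = (p + m₁ * q) % m , m%n<n (p + m₁ * q) m , Equivalence.from (a≡⇔ (q + (p + m₁ * q) % m) p) (begin
    (q + (p + m₁ * q) % m) % m ≡⟨ %-cong-+ˡ q m (m%n%n≡m%n (p + m₁ * q) m) ⟩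
    (q + (p + m₁ * q)) % m     ≡⟨ cong (_% m) (rearrange p q m₁) ⟩
    (p + q * m) % m            ≡⟨ [m+kn]%n≡m%n p q m ⟩
    p % m                      ∎)
    where
    open ≡-Reasoning
    rearrange : ∀ p q m₁ → q + (p + m₁ * q) ≡ p + q * suc m₁
    rearrange = solve-∀

  suc-cong : ∀ p q → a (suc p) ≡ a (suc q) ⇔ a p ≡ a q
  suc-cong p q = mk⇔
    (λ eq → Equivalence.from (a≡⇔ p q) (begin
      p % m              ≡⟨ unshift p ⟨
      (m₁ + suc p) % m   ≡⟨ %-cong-+ˡ m₁ m (Equivalence.to (a≡⇔ (suc p) (suc q)) eq) ⟩
      (m₁ + suc q) % m   ≡⟨ unshift q ⟩
      q % m              ∎))
    (λ eq → Equivalence.from (a≡⇔ (suc p) (suc q)) (%-cong-+ˡ 1 m (Equivalence.to (a≡⇔ p q) eq)))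
    where
    open ≡-Reasoning
    unshift : ∀ x → (m₁ + suc x) % m ≡ x % m
    unshift x = trans (cong (_% m) (trans (+-suc m₁ x) (+-comm m x))) ([m+n]%n≡m%n x m)

  enumeration : CyclicEnumeration G X m
  enumeration = record
    { vertex          = a
    ; vertex∈X        = λ p → Equivalence.from (X⇔ (a p)) (p mod m , refl)
    ; X⊆vertices      = X⊆vertices
    ; periodic        = λ p → Equivalence.from (a≡⇔ (p + m) p) ([m+n]%n≡m%n p m)
    ; injective       = injective
    ; offset          = offset
    ; suc-cong        = λ {p} {q} → suc-cong p q
    ; adj⇔consecutive = λ p q → ⇔-trans (G⇔ (p mod m) (q mod m)) (successor⇔ p q ⊎-⇔ successor⇔ q p)
    }

same-induced : ∀ {G H : Graph n} {X m} (E : CyclicEnumeration G X m) → let open CyclicEnumeration E in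
               (∀ p q → Adj H (vertex p) (vertex q) ⇔ Consecutive vertex p q) → SameInduced G H X
same-induced {G = G} {H} E H⇔ u v u∈X v∈X = on-vertices (X⊆vertices u∈X) (X⊆vertices v∈X)
  where
  open CyclicEnumeration E
  on-vertices : ∃ (λ p → vertex p ≡ u) → ∃ (λ q → vertex q ≡ v) → adj H u v ≡ adj G u v
  on-vertices (p , refl) (q , refl) = ≡true⇔⇒≡ (⇔-trans (H⇔ p q) (⇔-sym (adj⇔consecutive p q)))

lemma11 : (k n : ℕ) → 4 ≤ k → (G H : Graph n)
    → Connected G → Connected H
    → GirthAtLeast G (k + 1) → GirthAtLeast H (k + 1)
    → (∀ (Y : Subset n) → (ConnectedKSet G k Y ⇔ ConnectedKSet H k Y))
    → (X : Subset n) → k + 2 ≤ ∣ X ∣ → InducesCycle G X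
    → SameInduced G H X
lemma11 _ n (s≤s (s≤s _)) G H _ _ _ _ same X k+2≤∣X∣ (.(suc m₁) , s≤s {n = m₁} _ , f , f-injective , X⇔ , G⇔) =
  same-induced {H = H} E (same-connected-k-sets⇒adj⇔consecutive E (s≤s (s≤s z≤n)) (≤-trans k+2≤∣X∣ (Arcs.∣X∣≤m E)) same)
  where
  E = InducedCycle.enumeration m₁ f f-injective X⇔ G⇔
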